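{- Let $G$ be a finite simple graph on $n$ vertices with $\alpha(G)\le 2$. Suppose $G$ contains an induced subgraph $H$ isomorphic to the path $P_4$ such that for every edge $e\in E(H)$, every vertex of $V(G)\setminus V(H)$ is adjacent to at least one endpoint of $e$, and suppose that $G-V(H)$ contains $K_{\lceil (n-4)/2\rceil}$ as an immersion. Then $G$ contains $K_{\lceil n/2\rceil}$ as an immersion.
   Context: $\alpha(G)$ is the independence number; $P_4$ is the path on 4 vertices. A graph $G$ contains a graph $K$ as an immersion if there is an injective map $\phi\colon V(K)\to V(G)$ such that for every edge $uv\in E(K)$ there is a path $P_{uv}$ in $G$ with endpoints $\phi(u),\phi(v)$, the paths $P_{uv}$ are pairwise edge-disjoint, and no vertex of $\phi(V(K))$ is an interior vertex of any path $P_{uv}$. -}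

module Defs where

open import Data.Nat using (ℕ; suc; _+_; _≤_)
open import Data.Nat.Base using (_≡ᵇ_)
open import Data.Fin using (Fin; toℕ; _<_; _≟_)
open import Data.Bool using (Bool; true; false; not; _∨_; T)
open import Data.Product using (Σ; _×_; _,_; proj₁)
open import Data.List using (List; []; _∷_; _++_; length; allFin)
open import Data.Bool.ListAction using (any)
open import Data.List.Membership.Propositional using (_∈_; _∉_)
open import Data.List.Relation.Unary.Unique.Propositional using (Unique)
open import Data.List.Relation.Unary.AllPairs using (AllPairs)
open import Data.List.Relation.Unary.Linked using (Linked)
open import Relation.Binary.PropositionalEquality using (_≡_)
open import Relation.Nullary using (¬_)
open import Relation.Nullary.Decidable using (⌊_⌋)

record Graph (V : Set) : Set where
  field
    adj    : V → V → Bool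
    adj-sym    : ∀ u v → adj u v ≡ adj v u
    adj-irrefl : ∀ v → adj v v ≡ false

open Graph public

Adj : {V : Set} → Graph V → V → V → Set
Adj G u v = T (adj G u v)

IsIndependent : {V : Set} → Graph V → List V → Set
IsIndependent G xs = Unique xs × AllPairs (λ u v → ¬ Adj G u v) xs

IndependenceNumberAtMost : {V : Set} → Graph V → ℕ → Set
IndependenceNumberAtMost G k = ∀ xs → IsIndependent G xs → length xs ≤ k

complete : (m : ℕ) → Graph (Fin m)
complete m = record
  { adj = λ i j → not ⌊ i ≟ j ⌋
  ; adj-sym = λ i j → symAux i j
  ; adj-irrefl = λ i → irrAux i }
  where
  open import Relation.Nullary using (yes; no)
  open import Relation.Binary.PropositionalEquality using (refl; sym)
  symAux : ∀ (i j : Fin m) → not ⌊ i ≟ j ⌋ ≡ not ⌊ j ≟ i ⌋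
  symAux i j with i ≟ j | j ≟ i
  ... | yes _ | yes _ = refl
  ... | no _  | no _  = refl
  ... | yes p | no q  with q (sym p)
  ... | ()
  symAux i j | no q | yes p with q (sym p)
  ... | ()
  irrAux : ∀ (i : Fin m) → not ⌊ i ≟ i ⌋ ≡ false
  irrAux i with i ≟ i
  ... | yes _ = refl
  ... | no q with q refl
  ... | ()

pathGraph : (k : ℕ) → Graph (Fin k)
pathGraph k = record
  { adj = λ i j → e i j
  ; adj-sym = λ i j → Data.Bool.Properties.∨-comm (suc (toℕ i) ≡ᵇ toℕ j) (suc (toℕ j) ≡ᵇ toℕ i)
  ; adj-irrefl = λ i → irrAux (toℕ i) }
  where
  import Data.Bool.Properties
  open import Relation.Binary.PropositionalEquality using (refl)
  e : Fin k → Fin k → Bool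
  e i j = (suc (toℕ i) ≡ᵇ toℕ j) ∨ (suc (toℕ j) ≡ᵇ toℕ i)
  irrAux0 : ∀ (a : ℕ) → (suc a ≡ᵇ a) ≡ false
  irrAux0 Data.Nat.zero = refl
  irrAux0 (suc a) = irrAux0 a
  irrAux : ∀ (a : ℕ) → ((suc a ≡ᵇ a) ∨ (suc a ≡ᵇ a)) ≡ false
  irrAux a with suc a ≡ᵇ a | irrAux0 a
  ... | false | _ = refl

P₄ : Graph (Fin 4)
P₄ = pathGraph 4

deleteVertices : {V : Set} (G : Graph V) (S : V → Bool) → Graph (Σ V (λ v → T (not (S v))))
deleteVertices G S = record
  { adj = λ u v → adj G (proj₁ u) (proj₁ v)
  ; adj-sym = λ u v → adj-sym G (proj₁ u) (proj₁ v)
  ; adj-irrefl = λ v → adj-irrefl G (proj₁ v) }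

-- A path from a to b with interior vertex list ms: the vertex sequence
-- a ∷ ms ++ [b] has no repeated vertex and consecutive vertices are adjacent.
vertSeq : {V : Set} → V → List V → V → List V
vertSeq a ms b = a ∷ ms ++ b ∷ []

IsPath : {V : Set} → Graph V → V → List V → V → Set
IsPath G a ms b = Unique (vertSeq a ms b) × Linked (Adj G) (vertSeq a ms b)

steps : {V : Set} → List V → List (V × V)
steps [] = []
steps (x ∷ []) = []
steps (x ∷ y ∷ xs) = (x , y) ∷ steps (y ∷ xs)

EdgeDisjoint : {V : Set} → List V → List V → Set
EdgeDisjoint xs ys = ∀ a b → (a , b) ∈ steps xs → ((a , b) ∉ steps ys × (b , a) ∉ steps ys)

-- G contains K as an immersion (K on Fin k; every edge uv of K with u < v
-- gets a path with interior vertex list route u v).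
record Immersion {k : ℕ} {V : Set} (K : Graph (Fin k)) (G : Graph V) : Set where
  field
    φ       : Fin k → V
    φ-inj   : ∀ u v → φ u ≡ φ v → u ≡ v
    route   : Fin k → Fin k → List V
    isPath  : ∀ u v → u < v → Adj K u v → IsPath G (φ u) (route u v) (φ v)
    clean   : ∀ u v → u < v → Adj K u v → ∀ w → φ w ∉ route u v
    disjoint : ∀ u v u' v' → u < v → Adj K u v → u' < v' → Adj K u' v' →
               ¬ (u ≡ u' × v ≡ v') →
               EdgeDisjoint (vertSeq (φ u) (route u v) (φ v)) (vertSeq (φ u') (route u' v') (φ v'))

ContainsImmersion : {k : ℕ} {V : Set} → Graph (Fin k) → Graph V → Set
ContainsImmersion K G = Immersion K G

imageOf : {n : ℕ} → (Fin 4 → Fin n) → Fin n → Bool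
imageOf h v = any (λ i → ⌊ h i ≟ v ⌋) (allFin 4)

{-# OPTIONS --safe #-}
-- Write a b c d for the induced path. A vertex outside it dominates the three edges, so by α(G) ≤ 2 it is
-- complete to {a, b} or to {c, d}. Call a branch vertex of the given immersion of K_m (m = ⌈(n − 4)/2⌉)
-- deficient if it is not complete to {a, b}, and an outside non-branch vertex a helper if it is. Since
-- 2m ≤ n − 3, counting the n − 4 outside vertices shows that the deficient vertices can be matched
-- injectively to helpers, for (a, b) or else for (d, c). Then a and b become two new branch vertices: ab is
-- an edge, a side s reaches a branch vertex t directly if s ∼ t and otherwise along s x w t, where x is the
-- helper matched to t and w ∈ {c, d} a neighbour of x (t, being deficient, is complete to {c, d}). Every
-- new edge has an end in {a, b, c, d}, so it avoids the old routes, and the kinds of its two ends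
-- determine which new route it lies on.
module Submission where

open import Defs
open import Data.Nat using (ℕ; zero; suc; _+_; _∸_; _≤_; z≤n; s≤s; _≤?_; ⌈_/2⌉)
open import Data.Nat.Properties
  using ( +-suc; +-comm; m≤n⇒m≤1+n; ≤-trans; n≤1+n; +-monoʳ-≤; +-monoˡ-≤; +-mono-≤; +-cancelˡ-≤
        ; ≰⇒>; <-irrefl; n<1+n; module ≤-Reasoning)
open import Data.Fin as Fin using (Fin; zero; suc; _≟_; _<_; #_)
open import Data.Fin.Properties using (<⇒≢; injective⇒≤)
open import Data.Bool using (Bool; true; false; T; not; _∨_)
open import Data.Bool.Properties using (T-irrelevant; T-≡; T-not-≡; ∨-zeroʳ)
open import Data.Empty using (⊥; ⊥-elim)
open import Data.Product as Product using (Σ; _×_; _,_; -,_; proj₁; proj₂; ∃₂)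
open import Data.Sum as Sum using (_⊎_; inj₁; inj₂; [_,_]′)
open import Data.List using (List; []; _∷_; _++_; length; filter; map; tabulate; allFin)
open import Data.List.Properties using (length-removeAt′; length-tabulate; length-++; map-++)
open import Data.List.Relation.Unary.Any as Any using (here; there; _─_)
open import Data.List.Relation.Unary.Any.Properties as Any using (reverse⁺; reverse⁻; any⁺; any⁻)
open import Data.List.Relation.Unary.All as All using ([]; _∷_)
open import Data.List.Relation.Unary.AllPairs using ([]; _∷_)
open import Data.List.Relation.Unary.Linked using (Linked; []; [-]; _∷_)
import Data.List.Relation.Unary.Linked.Properties as Linked
open import Data.List.Membership.Propositional using (_∈_; _∉_)
open import Data.List.Membership.Propositional.Properties
  using (∈-filter⁻; ∈-filter⁺; ∈-++⁺ˡ; ∈-++⁺ʳ; ∈-tabulate⁺; ∈-tabulate⁻; ∈-map⁻)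
open import Data.List.Relation.Unary.Unique.Propositional using (Unique)
import Data.List.Relation.Unary.Unique.Propositional.Properties as Unique
open import Function using (id; _∘_; _⇔_; mk⇔; Equivalence)
open import Level using (0ℓ)
open import Relation.Binary.Definitions using (DecidableEquality)
open import Relation.Binary.PropositionalEquality using (_≡_; _≢_; refl; sym; trans; cong; cong₂; subst; subst₂)
open import Relation.Nullary using (¬_; yes; no; ¬?; contradiction)
open import Relation.Nullary.Decidable
  using (⌊_⌋; T?; _×-dec_; does; dec-true; dec-false; toSum; toWitness; fromWitness)
open import Relation.Unary using (Pred; Decidable)
open import Relation.Unary.Properties using (∁?)

steps-map : ∀ {A B : Set} (f : A → B) xs → steps (map f xs) ≡ map (Product.map f f) (steps xs)
steps-map f []           = refl
steps-map f (_ ∷ [])     = refl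
steps-map f (x ∷ y ∷ xs) = cong ((f x , f y) ∷_) (steps-map f (y ∷ xs))

T-not⇒¬T : ∀ {b} → T (not b) → ¬ T b
T-not⇒¬T {false} _ ()

¬T⇒T-not : ∀ {b} → ¬ T b → T (not b)
¬T⇒T-not {false} _  = _
¬T⇒T-not {true}  ¬t = ¬t _

complete-adj : ∀ {k} {i j : Fin k} → i ≢ j → Adj (complete k) i j
complete-adj {i = i} {j} i≢j with i ≟ j
... | yes i≡j = i≢j i≡j
... | no  _   = _

proj₁-injective : ∀ {A : Set} {p : A → Bool} {u v : Σ A (T ∘ p)} → proj₁ u ≡ proj₁ v → u ≡ v
proj₁-injective {u = x , t} {_ , t′} refl = cong (x ,_) (T-irrelevant t t′)

module _ {A : Set} {P Q : Pred A 0ℓ} (P? : Decidable P) (Q? : Decidable Q) where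

  length≤length-filter+length-filter : ∀ xs → (∀ {x} → x ∈ xs → P x ⊎ Q x) →
    length xs ≤ length (filter P? xs) + length (filter Q? xs)
  length≤length-filter+length-filter []       _     = z≤n
  length≤length-filter+length-filter (x ∷ xs) cover
    with P? x | Q? x | length≤length-filter+length-filter xs (cover ∘ there)
  ... | yes _ | yes _ | ih = s≤s (≤-trans ih (+-monoʳ-≤ _ (n≤1+n _)))
  ... | yes _ | no  _ | ih = s≤s ih
  ... | no  _ | yes _ | ih = subst (suc (length xs) ≤_) (sym (+-suc _ _)) (s≤s ih)
  ... | no ¬p | no ¬q | _  = contradiction (cover (here refl)) [ ¬p , ¬q ]′

  length-filter∁+length-filter∁≤length : ∀ xs → (∀ {x} → x ∈ xs → P x ⊎ Q x) →
    length (filter (∁? P?) xs) + length (filter (∁? Q?) xs) ≤ length xs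
  length-filter∁+length-filter∁≤length []       _     = z≤n
  length-filter∁+length-filter∁≤length (x ∷ xs) cover
    with P? x | Q? x | length-filter∁+length-filter∁≤length xs (cover ∘ there)
  ... | yes _ | yes _ | ih = m≤n⇒m≤1+n ih
  ... | yes _ | no  _ | ih = subst (_≤ suc (length xs)) (sym (+-suc _ _)) (s≤s ih)
  ... | no  _ | yes _ | ih = s≤s ih
  ... | no ¬p | no ¬q | _  = contradiction (cover (here refl)) [ ¬p , ¬q ]′

module _ {A : Set} where

  ∈-─⁺ : ∀ {x y : A} {ys} (x∈ys : x ∈ ys) → y ∈ ys → y ≢ x → y ∈ (ys ─ x∈ys)
  ∈-─⁺ (here refl) (here refl)  y≢x = contradiction refl y≢x
  ∈-─⁺ (here refl) (there y∈ys) _   = y∈ys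
  ∈-─⁺ (there _)   (here refl)  _   = here refl
  ∈-─⁺ (there x∈ys) (there y∈ys) y≢x = there (∈-─⁺ x∈ys y∈ys y≢x)

  module _ {P : Pred A 0ℓ} (P? : Decidable P) where

    length≤length+length-filter : ∀ {xs} ys → Unique xs → (∀ {x} → x ∈ xs → x ∈ ys ⊎ P x) →
      length xs ≤ length ys + length (filter P? xs)
    length≤length+length-filter {[]}     ys _ _ = z≤n
    length≤length+length-filter {x ∷ xs} ys (x∉xs ∷ uniq) split with P? x | split (here refl)
    ... | yes _ | _ = subst (suc (length xs) ≤_) (sym (+-suc _ _))
                        (s≤s (length≤length+length-filter ys uniq (split ∘ there)))
    ... | no ¬px | inj₂ px = contradiction px ¬px
    ... | no _   | inj₁ x∈ys = subst (λ k → suc (length xs) ≤ k + _) (sym (length-removeAt′ ys _))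
                        (s≤s (length≤length+length-filter (ys ─ x∈ys) uniq split′))
      where
      split′ : ∀ {y} → y ∈ xs → y ∈ (ys ─ x∈ys) ⊎ P y
      split′ y∈xs with split (there y∈xs)
      ... | inj₂ py   = inj₂ py
      ... | inj₁ y∈ys = inj₁ (∈-─⁺ x∈ys y∈ys (λ { refl → All.lookup x∉xs y∈xs refl }))

module _ {A B : Set} (_≟_ : DecidableEquality A) (default : B) where

  partnerIn : List A → List B → A → B
  partnerIn []       _        _ = default
  partnerIn (_ ∷ _)  []       _ = default
  partnerIn (x ∷ xs) (y ∷ ys) z with z ≟ x
  ... | yes _ = y
  ... | no  _ = partnerIn xs ys z

  private
    ∈-tail : ∀ {x z : A} {xs} → z ∈ x ∷ xs → z ≢ x → z ∈ xs
    ∈-tail (here z≡x) z≢x = contradiction z≡x z≢x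
    ∈-tail (there z∈xs) _ = z∈xs

  partnerIn-∈ : ∀ {z} xs ys → z ∈ xs → length xs ≤ length ys → partnerIn xs ys z ∈ ys
  partnerIn-∈ {z} (x ∷ xs) (y ∷ ys) z∈ (s≤s ≤ys) with z ≟ x
  ... | yes _   = here refl
  ... | no  z≢x = there (partnerIn-∈ xs ys (∈-tail z∈ z≢x) ≤ys)

  partnerIn-injective : ∀ {z z′} xs ys → Unique ys → z ∈ xs → z′ ∈ xs → length xs ≤ length ys →
    partnerIn xs ys z ≡ partnerIn xs ys z′ → z ≡ z′
  partnerIn-injective {z} {z′} (x ∷ xs) (y ∷ ys) (y∉ys ∷ uniq) z∈ z′∈ (s≤s ≤ys) eq
    with z ≟ x | z′ ≟ x
  ... | yes z≡x | yes z′≡x = trans z≡x (sym z′≡x)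
  ... | yes _   | no z′≢x  =
    contradiction eq (All.lookup y∉ys (partnerIn-∈ xs ys (∈-tail z′∈ z′≢x) ≤ys))
  ... | no z≢x  | yes _    =
    contradiction (sym eq) (All.lookup y∉ys (partnerIn-∈ xs ys (∈-tail z∈ z≢x) ≤ys))
  ... | no z≢x  | no z′≢x  =
    partnerIn-injective xs ys uniq (∈-tail z∈ z≢x) (∈-tail z′∈ z′≢x) ≤ys eq

module _ {V : Set} (G : Graph V) where

  Adj-sym : ∀ {u v} → Adj G u v → Adj G v u
  Adj-sym {u} {v} = subst T (adj-sym G u v)

  ¬Adj-sym : ∀ {u v} → ¬ Adj G u v → ¬ Adj G v u
  ¬Adj-sym ¬uv = ¬uv ∘ Adj-sym

  CompleteTo : V → V → V → Set
  CompleteTo x y v = Adj G x v × Adj G y v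

  CompleteTo? : ∀ x y → Decidable (CompleteTo x y)
  CompleteTo? x y v = T? (adj G x v) ×-dec T? (adj G y v)

  no-independent-triple : IndependenceNumberAtMost G 2 → ∀ {x y z} → x ≢ y → x ≢ z → y ≢ z →
    ¬ Adj G x y → ¬ Adj G x z → ¬ Adj G y z → ⊥
  no-independent-triple α x≢y x≢z y≢z x≁y x≁z y≁z
    with α _ ( ((x≢y ∷ x≢z ∷ []) ∷ (y≢z ∷ []) ∷ [] ∷ [])
             , ((x≁y ∷ x≁z ∷ []) ∷ (y≁z ∷ []) ∷ [] ∷ []))
  ... | s≤s (s≤s ())

module _ {V : Set} (G : Graph V) (S : V → Bool) where

  Outside : V → Set
  Outside v = T (not (S v))

  outside≢deleted : ∀ {u v} → Outside u → T (S v) → u ≢ v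
  outside≢deleted {u} out del refl with S u
  ... | true  = out
  ... | false = del

  record DominatingP₄ (a b c d : V) : Set where
    field
      a≢b : a ≢ b
      a≢c : a ≢ c
      a≢d : a ≢ d
      b≢c : b ≢ c
      b≢d : b ≢ d
      c≢d : c ≢ d
      a∼b : Adj G a b
      c∼d : Adj G c d
      a≁c : ¬ Adj G a c
      a≁d : ¬ Adj G a d
      b≁d : ¬ Adj G b d
      deleted : ∀ {v} → T (S v) ⇔ v ∈ a ∷ b ∷ c ∷ d ∷ []
      dominated : ∀ {v} → Outside v →
        (Adj G a v ⊎ Adj G b v) × (Adj G b v ⊎ Adj G c v) × (Adj G c v ⊎ Adj G d v)

    deleted⁺ : ∀ {v} → v ∈ a ∷ b ∷ c ∷ d ∷ [] → T (S v)
    deleted⁺ = Equivalence.from deleted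

  DominatingP₄-reverse : ∀ {a b c d} → DominatingP₄ a b c d → DominatingP₄ d c b a
  DominatingP₄-reverse P = record
    { a≢b = c≢d ∘ sym ; a≢c = b≢d ∘ sym ; a≢d = a≢d ∘ sym
    ; b≢c = b≢c ∘ sym ; b≢d = a≢c ∘ sym ; c≢d = a≢b ∘ sym
    ; a∼b = Adj-sym G c∼d ; c∼d = Adj-sym G a∼b
    ; a≁c = ¬Adj-sym G b≁d ; a≁d = ¬Adj-sym G a≁d ; b≁d = ¬Adj-sym G a≁c
    ; deleted = mk⇔ (reverse⁺ ∘ Equivalence.to deleted) (Equivalence.from deleted ∘ reverse⁻)
    ; dominated = λ out → let (ab , bc , cd) = dominated out in Sum.swap cd , Sum.swap bc , Sum.swap ab
    }
    where open DominatingP₄ P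

  module _ (α : IndependenceNumberAtMost G 2) {a b c d} (P : DominatingP₄ a b c d) where
    open DominatingP₄ P

    private
      a∈ : a ∈ a ∷ b ∷ c ∷ d ∷ []
      a∈ = here refl
      b∈ : b ∈ a ∷ b ∷ c ∷ d ∷ []
      b∈ = there (here refl)
      c∈ : c ∈ a ∷ b ∷ c ∷ d ∷ []
      c∈ = there (there (here refl))
      d∈ : d ∈ a ∷ b ∷ c ∷ d ∷ []
      d∈ = there (there (there (here refl)))

      triple : ∀ {v x y} → Outside v → x ∈ a ∷ b ∷ c ∷ d ∷ [] → y ∈ a ∷ b ∷ c ∷ d ∷ [] →
        x ≢ y →
        ¬ Adj G x v → ¬ Adj G y v → ¬ Adj G x y → ⊥
      triple out x∈ y∈ x≢y x≁v y≁v x≁y = no-independent-triple G α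
        (outside≢deleted out (deleted⁺ x∈)) (outside≢deleted out (deleted⁺ y∈)) x≢y
        (¬Adj-sym G x≁v) (¬Adj-sym G y≁v) x≁y

    outside-split : ∀ {v} → Outside v → CompleteTo G a b v ⊎ CompleteTo G c d v
    outside-split {v} out
      with T? (adj G a v) | T? (adj G b v) | T? (adj G c v) | T? (adj G d v) | dominated out
    ... | yes a∼v | yes b∼v | _       | _       | _            = inj₁ (a∼v , b∼v)
    ... | _       | _       | yes c∼v | yes d∼v | _            = inj₂ (c∼v , d∼v)
    ... | no a≁v  | no b≁v  | _       | _       | (ab , _)     = contradiction ab [ a≁v , b≁v ]′
    ... | yes _   | no b≁v  | no c≁v  | _       | (_ , bc , _) = contradiction bc [ b≁v , c≁v ]′
    ... | no a≁v  | yes _   | no c≁v  | _       | _ = ⊥-elim (triple out a∈ c∈ a≢c a≁v c≁v a≁c)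
    ... | no a≁v  | yes _   | yes _   | no d≁v  | _ = ⊥-elim (triple out a∈ d∈ a≢d a≁v d≁v a≁d)
    ... | yes _   | no b≁v  | yes _   | no d≁v  | _ = ⊥-elim (triple out b∈ d∈ b≢d b≁v d≁v b≁d)

module ImmersionVertices {n : ℕ} (G : Graph (Fin n)) (S : Fin n → Bool) {m : ℕ}
  (I : Immersion (complete m) (deleteVertices G S)) where

  open Immersion I
  open import Data.List.Membership.DecPropositional (_≟_ {n}) using (_∈?_)

  branch : Fin m → Fin n
  branch = proj₁ ∘ φ

  branch-outside : ∀ j → Outside G S (branch j)
  branch-outside = proj₂ ∘ φ

  branch-injective : ∀ {i j} → branch i ≡ branch j → i ≡ j
  branch-injective {i} {j} eq = φ-inj i j (proj₁-injective eq)

  branches : List (Fin n)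
  branches = tabulate branch

  Spare : Fin n → Set
  Spare v = Outside G S v × v ∉ branches

  Spare? : Decidable Spare
  Spare? v = T? (not (S v)) ×-dec ¬? (v ∈? branches)

  spares : List (Fin n)
  spares = filter Spare? (allFin n)

  branches-outside : ∀ {v} → v ∈ branches → Outside G S v
  branches-outside v∈ with ∈-tabulate⁻ v∈
  ... | j , refl = branch-outside j

  deficient helpers : Fin n → Fin n → List (Fin n)
  deficient x y = filter (∁? (CompleteTo? G x y)) branches
  helpers   x y = filter (CompleteTo? G x y) spares

  n≤length+m+length-spares : ∀ hs → (∀ {v} → T (S v) → v ∈ hs) → n ≤ length hs + m + length spares
  n≤length+m+length-spares hs deleted⊆hs =
    subst₂ _≤_ (length-tabulate id) (cong (_+ length spares) length-hs++branches)
      (length≤length+length-filter Spare? (hs ++ branches) (Unique.allFin⁺ n) classify)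
    where
    length-hs++branches : length (hs ++ branches) ≡ length hs + m
    length-hs++branches = trans (length-++ hs) (cong (length hs +_) (length-tabulate branch))
    classify : ∀ {v} → v ∈ allFin n → v ∈ hs ++ branches ⊎ Spare v
    classify {v} _ with T? (S v) | v ∈? branches
    ... | yes del | _        = inj₁ (∈-++⁺ˡ (deleted⊆hs del))
    ... | no ¬del | yes v∈bs = inj₁ (∈-++⁺ʳ hs v∈bs)
    ... | no ¬del | no v∉bs  = inj₂ (¬T⇒T-not ¬del , v∉bs)

  module _ (α : IndependenceNumberAtMost G 2) {a b c d} (P : DominatingP₄ G S a b c d) where

    open DominatingP₄ P

    outside-split′ : ∀ {v} → Outside G S v → CompleteTo G a b v ⊎ CompleteTo G d c v
    outside-split′ = Sum.map₂ Product.swap ∘ outside-split G S α P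

    length-spares≤length-helpers : length spares ≤ length (helpers a b) + length (helpers d c)
    length-spares≤length-helpers = length≤length-filter+length-filter (CompleteTo? G a b) (CompleteTo? G d c)
      spares (outside-split′ ∘ proj₁ ∘ proj₂ ∘ ∈-filter⁻ Spare? {xs = allFin n})

    length-deficient≤m : length (deficient a b) + length (deficient d c) ≤ m
    length-deficient≤m = subst (length (deficient a b) + length (deficient d c) ≤_) (length-tabulate branch)
      (length-filter∁+length-filter∁≤length (CompleteTo? G a b) (CompleteTo? G d c) branches
        (outside-split′ ∘ branches-outside))

    -- If neither matching fits, the spares (at least k − m of them) would number at most m − 2.
    deficient≤helpers⊎ : ∀ {k} → n ≡ 4 + k → m + m ≤ suc k →
      length (deficient a b) ≤ length (helpers a b) ⊎ length (deficient d c) ≤ length (helpers d c)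
    deficient≤helpers⊎ {k} refl 2m≤1+k
      with length (deficient a b) ≤? length (helpers a b) | length (deficient d c) ≤? length (helpers d c)
    ... | yes ab≤ | _       = inj₁ ab≤
    ... | no _    | yes dc≤ = inj₂ dc≤
    ... | no ab≰  | no dc≰  = ⊥-elim (<-irrefl refl (begin-strict
      suc k          <⟨ n<1+n (suc k) ⟩
      2 + k          ≤⟨ s≤s (s≤s k≤s+m) ⟩
      2 + s + m      ≤⟨ +-monoˡ-≤ m 2+s≤d₁+d₂ ⟩
      d₁ + d₂ + m    ≤⟨ +-monoˡ-≤ m length-deficient≤m ⟩
      m + m          ≤⟨ 2m≤1+k ⟩
      suc k          ∎))
      where
      open ≤-Reasoning
      s h₁ h₂ d₁ d₂ : ℕ
      s = length spares
      h₁ = length (helpers a b)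
      h₂ = length (helpers d c)
      d₁ = length (deficient a b)
      d₂ = length (deficient d c)

      k≤s+m : k ≤ s + m
      k≤s+m = subst (k ≤_) (+-comm m s)
        (+-cancelˡ-≤ 4 k (m + s) (n≤length+m+length-spares (a ∷ b ∷ c ∷ d ∷ []) (Equivalence.to deleted)))

      2+s≤d₁+d₂ : 2 + s ≤ d₁ + d₂
      2+s≤d₁+d₂ = begin
        2 + s            ≤⟨ s≤s (s≤s length-spares≤length-helpers) ⟩
        2 + (h₁ + h₂)    ≡⟨ cong suc (sym (+-suc h₁ h₂)) ⟩
        suc h₁ + suc h₂  ≤⟨ +-mono-≤ (≰⇒> ab≰) (≰⇒> dc≰) ⟩
        d₁ + d₂          ∎

module Extension {n : ℕ} (G : Graph (Fin n)) (S : Fin n → Bool) {m : ℕ}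
  (I : Immersion (complete m) (deleteVertices G S)) (α : IndependenceNumberAtMost G 2)
  {a b c d} (P : DominatingP₄ G S a b c d)
  (fits : length (ImmersionVertices.deficient G S I a b) ≤ length (ImmersionVertices.helpers G S I a b)) where

  open Immersion I
  open ImmersionVertices G S I
  open DominatingP₄ P
  open import Data.List.Membership.DecPropositional (_≟_ {n}) using (_∈?_)

  IsSide : Fin n → Set
  IsSide s = s ≡ a ⊎ s ≡ b

  a-side : IsSide a
  a-side = inj₁ refl

  b-side : IsSide b
  b-side = inj₂ refl

  side∼ : ∀ {s v} → IsSide s → CompleteTo G a b v → Adj G s v
  side∼ (inj₁ refl) = proj₁
  side∼ (inj₂ refl) = proj₂

  deficient-cd : ∀ {t} → t ∈ deficient a b → CompleteTo G c d t
  deficient-cd t∈ with ∈-filter⁻ (∁? (CompleteTo? G a b)) t∈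
  ... | t∈bs , ¬ab = [ ⊥-elim ∘ ¬ab , id ]′ (outside-split G S α P (branches-outside t∈bs))

  side≁⇒deficient : ∀ {s} j → IsSide s → ¬ Adj G s (branch j) → branch j ∈ deficient a b
  side≁⇒deficient j s-side s≁t =
    ∈-filter⁺ (∁? (CompleteTo? G a b)) (∈-tabulate⁺ j) (s≁t ∘ side∼ s-side)

  sides≁⇒same : ∀ {s s′ t} → IsSide s → IsSide s′ → Outside G S t →
    ¬ Adj G s t → ¬ Adj G s′ t → s ≡ s′
  sides≁⇒same (inj₁ refl) (inj₁ refl) _ _ _ = refl
  sides≁⇒same (inj₂ refl) (inj₂ refl) _ _ _ = refl
  sides≁⇒same (inj₁ refl) (inj₂ refl) out a≁t b≁t = contradiction (proj₁ (dominated out)) [ a≁t , b≁t ]′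
  sides≁⇒same (inj₂ refl) (inj₁ refl) out b≁t a≁t = contradiction (proj₁ (dominated out)) [ a≁t , b≁t ]′

  partner : Fin n → Fin n
  partner = partnerIn _≟_ a (deficient a b) (helpers a b)

  partner-helps : ∀ {t} → t ∈ deficient a b → partner t ∈ helpers a b
  partner-helps t∈ = partnerIn-∈ _≟_ a _ _ t∈ fits

  partner-spare : ∀ {t} → t ∈ deficient a b → Spare (partner t)
  partner-spare t∈ =
    proj₂ (∈-filter⁻ Spare? {xs = allFin n} (proj₁ (∈-filter⁻ (CompleteTo? G a b) (partner-helps t∈))))

  partner-injective : ∀ {t t′} → t ∈ deficient a b → t′ ∈ deficient a b →
    partner t ≡ partner t′ → t ≡ t′
  partner-injective t∈ t′∈ = partnerIn-injective _≟_ a _ _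
    (Unique.filter⁺ (CompleteTo? G a b) (Unique.filter⁺ Spare? (Unique.allFin⁺ n))) t∈ t′∈ fits

  relay : Fin n → Fin n
  relay x with T? (adj G c x)
  ... | yes _ = c
  ... | no  _ = d

  relay∈cd : ∀ x → relay x ≡ c ⊎ relay x ≡ d
  relay∈cd x with T? (adj G c x)
  ... | yes _ = inj₁ refl
  ... | no  _ = inj₂ refl

  relay∼ : ∀ {x} → Outside G S x → Adj G x (relay x)
  relay∼ {x} out with T? (adj G c x)
  ... | yes c∼x = Adj-sym G c∼x
  ... | no  c≁x = Adj-sym G ([ ⊥-elim ∘ c≁x , id ]′ (proj₂ (proj₂ (dominated out))))

  relay∼deficient : ∀ {t} x → t ∈ deficient a b → Adj G (relay x) t
  relay∼deficient x t∈ with relay∈cd x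
  ... | inj₁ eq = subst (λ w → Adj G w _) (sym eq) (proj₁ (deficient-cd t∈))
  ... | inj₂ eq = subst (λ w → Adj G w _) (sym eq) (proj₂ (deficient-cd t∈))

  -- A new route runs sideRole → branchRole or sideRole → spareRole → relayRole → branchRole, so the roles of
  -- the ends of a new edge fix its direction and its position on the route.
  data Role : Set where
    sideRole relayRole branchRole spareRole : Role

  roleᵇ : Bool → Bool → Bool → Role
  roleᵇ true  true  _     = sideRole
  roleᵇ true  false _     = relayRole
  roleᵇ false _     true  = branchRole
  roleᵇ false _     false = spareRole

  role : Fin n → Role
  role v = roleᵇ (S v) (does (v ≟ a) ∨ does (v ≟ b)) (does (v ∈? branches))

  role-≡ : ∀ {v x y z} → S v ≡ x → does (v ≟ a) ∨ does (v ≟ b) ≡ y → does (v ∈? branches) ≡ z →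
    role v ≡ roleᵇ x y z
  role-≡ refl refl refl = refl

  role-side : ∀ {s} → IsSide s → role s ≡ sideRole
  role-side (inj₁ refl) = role-≡ (Equivalence.to T-≡ (deleted⁺ (here refl)))
    (cong (_∨ does (a ≟ b)) (dec-true (a ≟ a) refl)) refl
  role-side (inj₂ refl) = role-≡ (Equivalence.to T-≡ (deleted⁺ (there (here refl))))
    (trans (cong (does (b ≟ a) ∨_) (dec-true (b ≟ b) refl)) (∨-zeroʳ _)) refl

  role-relay : ∀ x → role (relay x) ≡ relayRole
  role-relay x with relay x | relay∈cd x
  ... | _ | inj₁ refl = role-≡ (Equivalence.to T-≡ (deleted⁺ (there (there (here refl)))))
    (cong₂ _∨_ (dec-false (c ≟ a) (a≢c ∘ sym)) (dec-false (c ≟ b) (b≢c ∘ sym))) refl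
  ... | _ | inj₂ refl = role-≡ (Equivalence.to T-≡ (deleted⁺ (there (there (there (here refl))))))
    (cong₂ _∨_ (dec-false (d ≟ a) (a≢d ∘ sym)) (dec-false (d ≟ b) (b≢d ∘ sym))) refl

  role-member : ∀ {v} → Outside G S v → v ∈ branches → role v ≡ branchRole
  role-member out v∈bs = role-≡ (Equivalence.to T-not-≡ out) refl (dec-true (_ ∈? branches) v∈bs)

  role-spare : ∀ {v} → Spare v → role v ≡ spareRole
  role-spare (out , v∉bs) = role-≡ (Equivalence.to T-not-≡ out) refl (dec-false (_ ∈? branches) v∉bs)

  role-branch : ∀ j → role (branch j) ≡ branchRole
  role-branch j = role-member (branch-outside j) (∈-tabulate⁺ j)

  role-outside : ∀ {v} → Outside G S v → role v ≡ branchRole ⊎ role v ≡ spareRole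
  role-outside {v} out = Sum.map (role-member out) (role-spare ∘ (out ,_)) (toSum (v ∈? branches))

  outside-role≢ : ∀ {v r} → Outside G S v → role v ≡ r → r ≢ branchRole → r ≢ spareRole → ⊥
  outside-role≢ out refl ≢branch ≢spare = [ ≢branch , ≢spare ]′ (role-outside out)

  roles⇒≢ : ∀ {u v r r′} → role u ≡ r → role v ≡ r′ → r ≢ r′ → u ≢ v
  roles⇒≢ refl refl r≢r′ = r≢r′ ∘ cong role

  newRoute : Fin n → Fin m → List (Fin n)
  newRoute s j with T? (adj G s (branch j))
  ... | yes _ = []
  ... | no  _ = partner (branch j) ∷ relay (partner (branch j)) ∷ []

  newRoute-isPath : ∀ {s} j → IsSide s → IsPath G s (newRoute s j) (branch j)
  newRoute-isPath {s} j s-side with T? (adj G s (branch j))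
  ... | yes s∼t = ((s≢t ∷ []) ∷ [] ∷ []) , (s∼t ∷ [-])
    where
    s≢t : s ≢ branch j
    s≢t = roles⇒≢ (role-side s-side) (role-branch j) λ ()
  ... | no  s≁t = ((s≢x ∷ s≢w ∷ s≢t ∷ []) ∷ (x≢w ∷ x≢t ∷ []) ∷ (w≢t ∷ []) ∷ [] ∷ [])
                , (s∼x ∷ x∼w ∷ w∼t ∷ [-])
    where
    t x w : Fin n
    t = branch j
    x = partner t
    w = relay x
    t∈ : t ∈ deficient a b
    t∈ = side≁⇒deficient j s-side s≁t
    x-spare : Spare x
    x-spare = partner-spare t∈
    s∼x : Adj G s x
    s∼x = side∼ s-side (proj₂ (∈-filter⁻ (CompleteTo? G a b) {xs = spares} (partner-helps t∈)))
    x∼w : Adj G x w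
    x∼w = relay∼ (proj₁ x-spare)
    w∼t : Adj G w t
    w∼t = relay∼deficient x t∈
    s≢x : s ≢ x
    s≢x = roles⇒≢ (role-side s-side) (role-spare x-spare) λ ()
    s≢w : s ≢ w
    s≢w = roles⇒≢ (role-side s-side) (role-relay x) λ ()
    s≢t : s ≢ t
    s≢t = roles⇒≢ (role-side s-side) (role-branch j) λ ()
    x≢w : x ≢ w
    x≢w = roles⇒≢ (role-spare x-spare) (role-relay x) λ ()
    x≢t : x ≢ t
    x≢t = roles⇒≢ (role-spare x-spare) (role-branch j) λ ()
    w≢t : w ≢ t
    w≢t = roles⇒≢ (role-relay x) (role-branch j) λ ()

  newRoute-roles : ∀ {s} j → IsSide s → ∀ {v} → v ∈ newRoute s j →
    role v ≡ spareRole ⊎ role v ≡ relayRole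
  newRoute-roles {s} j s-side v∈ with T? (adj G s (branch j)) | v∈
  ... | no s≁t | here refl         = inj₁ (role-spare (partner-spare (side≁⇒deficient j s-side s≁t)))
  ... | no _   | there (here refl) = inj₂ (role-relay _)

  data NewRouteStep (s : Fin n) (j : Fin m) (p q : Fin n) : Role → Role → Set where
    direct    : p ≡ s → q ≡ branch j → NewRouteStep s j p q sideRole branchRole
    toHelper  : ¬ Adj G s (branch j) → p ≡ s → q ≡ partner (branch j) → NewRouteStep s j p q sideRole spareRole
    toRelay   : ¬ Adj G s (branch j) → p ≡ partner (branch j) → q ≡ relay (partner (branch j)) →
                NewRouteStep s j p q spareRole relayRole
    fromRelay : ¬ Adj G s (branch j) → p ≡ relay (partner (branch j)) → q ≡ branch j →
                NewRouteStep s j p q relayRole branchRole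

  newRoute-step : ∀ s j {p q} → (p , q) ∈ steps (vertSeq s (newRoute s j) (branch j)) →
    ∃₂ (NewRouteStep s j p q)
  newRoute-step s j step with T? (adj G s (branch j)) | step
  ... | yes _   | here refl                 = -, -, direct refl refl
  ... | no  s≁t | here refl                 = -, -, toHelper s≁t refl refl
  ... | no  s≁t | there (here refl)         = -, -, toRelay s≁t refl refl
  ... | no  s≁t | there (there (here refl)) = -, -, fromRelay s≁t refl refl

  module _ {s : Fin n} {j : Fin m} (s-side : IsSide s) where

    newRouteStep-roles : ∀ {p q r r′} → NewRouteStep s j p q r r′ → role p ≡ r × role q ≡ r′
    newRouteStep-roles (direct refl refl)        = role-side s-side , role-branch j
    newRouteStep-roles (toHelper s≁t refl refl)  =
      role-side s-side , role-spare (partner-spare (side≁⇒deficient j s-side s≁t))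
    newRouteStep-roles (toRelay s≁t refl refl)   =
      role-spare (partner-spare (side≁⇒deficient j s-side s≁t)) , role-relay _
    newRouteStep-roles (fromRelay s≁t refl refl) = role-relay _ , role-branch j

    newRouteStep-¬outside : ∀ {p q r r′} → NewRouteStep s j p q r r′ → Outside G S p → Outside G S q → ⊥
    newRouteStep-¬outside st p-out q-out with newRouteStep-roles st | st
    ... | p-role , _ | direct _ _        = outside-role≢ p-out p-role (λ ()) (λ ())
    ... | p-role , _ | toHelper _ _ _    = outside-role≢ p-out p-role (λ ()) (λ ())
    ... | _ , q-role | toRelay _ _ _     = outside-role≢ q-out q-role (λ ()) (λ ())
    ... | p-role , _ | fromRelay _ _ _   = outside-role≢ p-out p-role (λ ()) (λ ())

  module _ {s s′} (s-side : IsSide s) (s′-side : IsSide s′) where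

    private
      same-branch : ∀ {j j′} → j ≡ j′ → ¬ Adj G s (branch j) → ¬ Adj G s′ (branch j′) →
        s ≡ s′ × j ≡ j′
      same-branch refl s≁t s′≁t = sides≁⇒same s-side s′-side (branch-outside _) s≁t s′≁t , refl

      partner-branch-injective : ∀ {j j′} → ¬ Adj G s (branch j) → ¬ Adj G s′ (branch j′) →
        partner (branch j) ≡ partner (branch j′) → j ≡ j′
      partner-branch-injective {j} {j′} s≁t s′≁t =
        branch-injective ∘
        partner-injective (side≁⇒deficient j s-side s≁t) (side≁⇒deficient j′ s′-side s′≁t)

      owner : ∀ {j j′ p q r r′} → NewRouteStep s j p q r r′ → NewRouteStep s′ j′ p q r r′ →
        s ≡ s′ × j ≡ j′
      owner (direct e₁ e₂)         (direct f₁ f₂)          =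
        trans (sym e₁) f₁ , branch-injective (trans (sym e₂) f₂)
      owner (toHelper s≁t e₁ e₂)   (toHelper s′≁t f₁ f₂)   =
        trans (sym e₁) f₁ , partner-branch-injective s≁t s′≁t (trans (sym e₂) f₂)
      owner (toRelay s≁t e₁ _)     (toRelay s′≁t f₁ _)     =
        same-branch (partner-branch-injective s≁t s′≁t (trans (sym e₁) f₁)) s≁t s′≁t
      owner (fromRelay s≁t _ e₂)   (fromRelay s′≁t _ f₂)   =
        same-branch (branch-injective (trans (sym e₂) f₂)) s≁t s′≁t

      no-reversal : ∀ {j j′ p q r r′} → NewRouteStep s j p q r r′ → NewRouteStep s′ j′ q p r′ r → ⊥
      no-reversal (direct _ _)        ()
      no-reversal (toHelper _ _ _)    ()
      no-reversal (toRelay _ _ _)     ()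
      no-reversal (fromRelay _ _ _)   ()

    newRouteStep-owner : ∀ {j j′ p q r₁ r₂ r₃ r₄} →
      NewRouteStep s j p q r₁ r₂ → NewRouteStep s′ j′ p q r₃ r₄ → s ≡ s′ × j ≡ j′
    newRouteStep-owner st st′
      with trans (sym (proj₁ (newRouteStep-roles s-side st))) (proj₁ (newRouteStep-roles s′-side st′))
         | trans (sym (proj₂ (newRouteStep-roles s-side st))) (proj₂ (newRouteStep-roles s′-side st′))
    ... | refl | refl = owner st st′

    newRouteStep-oriented : ∀ {j j′ p q r₁ r₂ r₃ r₄} →
      NewRouteStep s j p q r₁ r₂ → NewRouteStep s′ j′ q p r₃ r₄ → ⊥
    newRouteStep-oriented st st′
      with trans (sym (proj₁ (newRouteStep-roles s-side st))) (proj₂ (newRouteStep-roles s′-side st′))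
         | trans (sym (proj₂ (newRouteStep-roles s-side st))) (proj₁ (newRouteStep-roles s′-side st′))
    ... | refl | refl = no-reversal st st′

  newRouteStep-target-¬side : ∀ {s j p q r r′} → IsSide s → NewRouteStep s j p q r r′ → ¬ IsSide q
  newRouteStep-target-¬side s-side st q-side
    with trans (sym (proj₂ (newRouteStep-roles s-side st))) (role-side q-side)
  newRouteStep-target-¬side _ () _ | refl

  φ′ : Fin (2 + m) → Fin n
  φ′ zero          = a
  φ′ (suc zero)    = b
  φ′ (suc (suc j)) = branch j

  role-φ′ : ∀ w → role (φ′ w) ≡ sideRole ⊎ role (φ′ w) ≡ branchRole
  role-φ′ zero          = inj₁ (role-side a-side)
  role-φ′ (suc zero)    = inj₁ (role-side b-side)
  role-φ′ (suc (suc j)) = inj₂ (role-branch j)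

  branch≢deleted : ∀ j {v} → v ∈ a ∷ b ∷ c ∷ d ∷ [] → branch j ≢ v
  branch≢deleted j v∈ = outside≢deleted G S (branch-outside j) (deleted⁺ v∈)

  route′ : Fin (2 + m) → Fin (2 + m) → List (Fin n)
  route′ zero          (suc (suc j)) = newRoute a j
  route′ (suc zero)    (suc (suc j)) = newRoute b j
  route′ (suc (suc i)) (suc (suc j)) = map proj₁ (route i j)
  route′ _             _             = []

  OldSeq : Fin m → Fin m → List (Σ (Fin n) (Outside G S))
  OldSeq i j = vertSeq (φ i) (route i j) (φ j)

  oldSeq-≡ : ∀ i j → vertSeq (branch i) (map proj₁ (route i j)) (branch j) ≡ map proj₁ (OldSeq i j)
  oldSeq-≡ i j = cong (branch i ∷_) (sym (map-++ proj₁ (route i j) _))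

  data NewBranchStep : Fin (2 + m) → Fin (2 + m) → Fin n → Fin n → Set where
    sideEdge : ∀ {p q} → p ≡ a → q ≡ b → NewBranchStep zero (suc zero) p q
    fromA    : ∀ {j p q r r′} → NewRouteStep a j p q r r′ → NewBranchStep zero (suc (suc j)) p q
    fromB    : ∀ {j p q r r′} → NewRouteStep b j p q r r′ → NewBranchStep (suc zero) (suc (suc j)) p q

  data RouteStep′ (u v : Fin (2 + m)) (p q : Fin n) : Set where
    new : NewBranchStep u v p q → RouteStep′ u v p q
    old : ∀ {i j} (p′ q′ : Σ (Fin n) (Outside G S)) → u ≡ suc (suc i) → v ≡ suc (suc j) → i < j →
          proj₁ p′ ≡ p → proj₁ q′ ≡ q → (p′ , q′) ∈ steps (OldSeq i j) → RouteStep′ u v p q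

  routeStep′ : ∀ {u v p q} → u < v → (p , q) ∈ steps (vertSeq (φ′ u) (route′ u v) (φ′ v)) →
    RouteStep′ u v p q
  routeStep′ {zero}        {suc zero}    _ (here refl) = new (sideEdge refl refl)
  routeStep′ {zero}        {suc (suc j)} _ st          = new (fromA (proj₂ (proj₂ (newRoute-step a j st))))
  routeStep′ {suc zero}    {suc (suc j)} _ st          = new (fromB (proj₂ (proj₂ (newRoute-step b j st))))
  routeStep′ {suc (suc i)} {suc (suc j)} {p} {q} (s≤s (s≤s i<j)) st
    with ∈-map⁻ _ (subst ((p , q) ∈_) (trans (cong steps (oldSeq-≡ i j)) (steps-map proj₁ (OldSeq i j))) st)
  ... | (p′ , q′) , st′ , refl = old p′ q′ refl refl i<j refl refl st′
  routeStep′ {zero}        {zero}        ()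
  routeStep′ {suc zero}    {zero}        ()
  routeStep′ {suc zero}    {suc zero}    (s≤s ())
  routeStep′ {suc (suc _)} {zero}        ()
  routeStep′ {suc (suc _)} {suc zero}    (s≤s ())

  newBranchStep-¬outside : ∀ {u v p q} → NewBranchStep u v p q → Outside G S p → Outside G S q → ⊥
  newBranchStep-¬outside (sideEdge refl _) p-out _ = outside≢deleted G S p-out (deleted⁺ (here refl)) refl
  newBranchStep-¬outside (fromA st)           = newRouteStep-¬outside a-side st
  newBranchStep-¬outside (fromB st)           = newRouteStep-¬outside b-side st

  private
    same-target : ∀ {X : Set} {u : Fin (2 + m)} {j j′ : Fin m} → X × j ≡ j′ →
      u ≡ u × Fin.suc (Fin.suc j) ≡ Fin.suc (Fin.suc j′)
    same-target (_ , refl) = refl , refl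

  newBranchStep-shared : ∀ {u v u′ v′ p q} → NewBranchStep u v p q → NewBranchStep u′ v′ p q →
    u ≡ u′ × v ≡ v′
  newBranchStep-shared (sideEdge _ _)   (sideEdge _ _)   = refl , refl
  newBranchStep-shared (sideEdge _ q≡b) (fromA st)       = ⊥-elim (newRouteStep-target-¬side a-side st (inj₂ q≡b))
  newBranchStep-shared (sideEdge _ q≡b) (fromB st)       = ⊥-elim (newRouteStep-target-¬side b-side st (inj₂ q≡b))
  newBranchStep-shared (fromA st)       (sideEdge _ q≡b) = ⊥-elim (newRouteStep-target-¬side a-side st (inj₂ q≡b))
  newBranchStep-shared (fromB st)       (sideEdge _ q≡b) = ⊥-elim (newRouteStep-target-¬side b-side st (inj₂ q≡b))
  newBranchStep-shared (fromA st)       (fromA st′)      = same-target (newRouteStep-owner a-side a-side st st′)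
  newBranchStep-shared (fromB st)       (fromB st′)      = same-target (newRouteStep-owner b-side b-side st st′)
  newBranchStep-shared (fromA st)       (fromB st′)      =
    ⊥-elim (a≢b (proj₁ (newRouteStep-owner a-side b-side st st′)))
  newBranchStep-shared (fromB st)       (fromA st′)      =
    ⊥-elim (a≢b (sym (proj₁ (newRouteStep-owner b-side a-side st st′))))

  newBranchStep-oriented : ∀ {u v u′ v′ p q} → NewBranchStep u v p q → NewBranchStep u′ v′ q p → ⊥
  newBranchStep-oriented (sideEdge p≡a _) (sideEdge _ p≡b) = a≢b (trans (sym p≡a) p≡b)
  newBranchStep-oriented (sideEdge p≡a _) (fromA st)       = newRouteStep-target-¬side a-side st (inj₁ p≡a)
  newBranchStep-oriented (sideEdge p≡a _) (fromB st)       = newRouteStep-target-¬side b-side st (inj₁ p≡a)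
  newBranchStep-oriented (fromA st)       (sideEdge q≡a _) = newRouteStep-target-¬side a-side st (inj₁ q≡a)
  newBranchStep-oriented (fromB st)       (sideEdge q≡a _) = newRouteStep-target-¬side b-side st (inj₁ q≡a)
  newBranchStep-oriented (fromA st)       (fromA st′)      = newRouteStep-oriented a-side a-side st st′
  newBranchStep-oriented (fromA st)       (fromB st′)      = newRouteStep-oriented a-side b-side st st′
  newBranchStep-oriented (fromB st)       (fromA st′)      = newRouteStep-oriented b-side a-side st st′
  newBranchStep-oriented (fromB st)       (fromB st′)      = newRouteStep-oriented b-side b-side st st′

  private
    old-disjoint : ∀ {i j i′ j′} → i < j → i′ < j′ → ¬ (i ≡ i′ × j ≡ j′) →
      EdgeDisjoint (OldSeq i j) (OldSeq i′ j′)
    old-disjoint {i} {j} {i′} {j′} i<j i′<j′ =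
      disjoint i j i′ j′ i<j (complete-adj (<⇒≢ i<j)) i′<j′ (complete-adj (<⇒≢ i′<j′))

    suc²-pair≢ : ∀ {i j i′ j′ : Fin m} →
      ¬ (Fin.suc (Fin.suc i) ≡ Fin.suc (Fin.suc i′) × Fin.suc (Fin.suc j) ≡ Fin.suc (Fin.suc j′)) →
      ¬ (i ≡ i′ × j ≡ j′)
    suc²-pair≢ ne (refl , refl) = ne (refl , refl)

  step-shared : ∀ {u v u′ v′ p q} → RouteStep′ u v p q → RouteStep′ u′ v′ p q →
    ¬ (u ≡ u′ × v ≡ v′) → ⊥
  step-shared (new e) (new e′) ne = ne (newBranchStep-shared e e′)
  step-shared (new e) (old p′ q′ _ _ _ refl refl _) _ = newBranchStep-¬outside e (proj₂ p′) (proj₂ q′)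
  step-shared (old p′ q′ _ _ _ refl refl _) (new e′) _ = newBranchStep-¬outside e′ (proj₂ p′) (proj₂ q′)
  step-shared (old p₁ q₁ refl refl i<j refl refl st) (old p₂ q₂ refl refl i′<j′ p≡ q≡ st′) ne
    with proj₁-injective {u = p₁} {p₂} (sym p≡) | proj₁-injective {u = q₁} {q₂} (sym q≡)
  ... | refl | refl = proj₁ (old-disjoint i<j i′<j′ (suc²-pair≢ ne) p₁ q₁ st) st′

  step-reversed : ∀ {u v u′ v′ p q} → RouteStep′ u v p q → RouteStep′ u′ v′ q p →
    ¬ (u ≡ u′ × v ≡ v′) → ⊥
  step-reversed (new e) (new e′) _ = newBranchStep-oriented e e′
  step-reversed (new e) (old p′ q′ _ _ _ refl refl _) _ = newBranchStep-¬outside e (proj₂ q′) (proj₂ p′)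
  step-reversed (old p′ q′ _ _ _ refl refl _) (new e′) _ = newBranchStep-¬outside e′ (proj₂ q′) (proj₂ p′)
  step-reversed (old p₁ q₁ refl refl i<j refl refl st) (old p₂ q₂ refl refl i′<j′ q≡ p≡ st′) ne
    with proj₁-injective {u = q₁} {p₂} (sym q≡) | proj₁-injective {u = p₁} {q₂} (sym p≡)
  ... | refl | refl = proj₂ (old-disjoint i<j i′<j′ (suc²-pair≢ ne) p₁ q₁ st) st′

  φ′-injective : ∀ u v → φ′ u ≡ φ′ v → u ≡ v
  φ′-injective zero          zero          _  = refl
  φ′-injective (suc zero)    (suc zero)    _  = refl
  φ′-injective (suc (suc i)) (suc (suc j)) eq = cong (λ k → suc (suc k)) (branch-injective eq)
  φ′-injective zero          (suc zero)    eq = ⊥-elim (a≢b eq)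
  φ′-injective (suc zero)    zero          eq = ⊥-elim (a≢b (sym eq))
  φ′-injective zero          (suc (suc j)) eq = ⊥-elim (branch≢deleted j (here refl) (sym eq))
  φ′-injective (suc zero)    (suc (suc j)) eq = ⊥-elim (branch≢deleted j (there (here refl)) (sym eq))
  φ′-injective (suc (suc i)) zero          eq = ⊥-elim (branch≢deleted i (here refl) eq)
  φ′-injective (suc (suc i)) (suc zero)    eq = ⊥-elim (branch≢deleted i (there (here refl)) eq)

  isPath′ : ∀ u v → u < v → Adj (complete (2 + m)) u v → IsPath G (φ′ u) (route′ u v) (φ′ v)
  isPath′ zero          (suc zero)    _ _ = ((a≢b ∷ []) ∷ [] ∷ []) , (a∼b ∷ [-])
  isPath′ zero          (suc (suc j)) _ _ = newRoute-isPath j a-side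
  isPath′ (suc zero)    (suc (suc j)) _ _ = newRoute-isPath j b-side
  isPath′ (suc (suc i)) (suc (suc j)) (s≤s (s≤s i<j)) _
    with isPath i j i<j (complete-adj (<⇒≢ i<j))
  ... | unique , linked = subst (λ xs → Unique xs × Linked (Adj G) xs) (sym (oldSeq-≡ i j))
                            (Unique.map⁺ proj₁-injective unique , Linked.map⁺ linked)
  isPath′ zero          zero          () _
  isPath′ (suc zero)    zero          () _
  isPath′ (suc zero)    (suc zero)    (s≤s ()) _
  isPath′ (suc (suc _)) zero          () _
  isPath′ (suc (suc _)) (suc zero)    (s≤s ()) _

  φ′∉newRoute : ∀ {s} j → IsSide s → ∀ w → φ′ w ∉ newRoute s j
  φ′∉newRoute j s-side w w∈ with role-φ′ w | newRoute-roles j s-side w∈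
  ... | inj₁ e | inj₁ e′ = contradiction (trans (sym e) e′) λ ()
  ... | inj₁ e | inj₂ e′ = contradiction (trans (sym e) e′) λ ()
  ... | inj₂ e | inj₁ e′ = contradiction (trans (sym e) e′) λ ()
  ... | inj₂ e | inj₂ e′ = contradiction (trans (sym e) e′) λ ()

  φ′∉oldRoute : ∀ {i j} → i < j → ∀ w → φ′ w ∉ map proj₁ (route i j)
  φ′∉oldRoute i<j zero w∈ with ∈-map⁻ proj₁ w∈
  ... | y , _ , eq = outside≢deleted G S (proj₂ y) (deleted⁺ (here refl)) (sym eq)
  φ′∉oldRoute i<j (suc zero) w∈ with ∈-map⁻ proj₁ w∈
  ... | y , _ , eq = outside≢deleted G S (proj₂ y) (deleted⁺ (there (here refl))) (sym eq)
  φ′∉oldRoute {i} {j} i<j (suc (suc k)) w∈ with ∈-map⁻ proj₁ w∈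
  ... | y , y∈ , eq with proj₁-injective {u = φ k} {y} eq
  ...   | refl = clean i j i<j (complete-adj (<⇒≢ i<j)) k y∈

  clean′ : ∀ u v → u < v → Adj (complete (2 + m)) u v → ∀ w → φ′ w ∉ route′ u v
  clean′ zero          (suc zero)    _ _ _ ()
  clean′ zero          (suc (suc j)) _ _ w = φ′∉newRoute j a-side w
  clean′ (suc zero)    (suc (suc j)) _ _ w = φ′∉newRoute j b-side w
  clean′ (suc (suc i)) (suc (suc j)) (s≤s (s≤s i<j)) _ w = φ′∉oldRoute i<j w
  clean′ zero          zero          () _
  clean′ (suc zero)    zero          () _
  clean′ (suc zero)    (suc zero)    (s≤s ()) _
  clean′ (suc (suc _)) zero          () _
  clean′ (suc (suc _)) (suc zero)    (s≤s ()) _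

  immersion : ContainsImmersion (complete (2 + m)) G
  immersion = record
    { φ        = φ′
    ; φ-inj    = φ′-injective
    ; route    = route′
    ; isPath   = isPath′
    ; clean    = clean′
    ; disjoint = λ _ _ _ _ u<v _ u′<v′ _ ne _ _ st →
        (λ st′ → step-shared (routeStep′ u<v st) (routeStep′ u′<v′ st′) ne) ,
        (λ st′ → step-reversed (routeStep′ u<v st) (routeStep′ u′<v′ st′) ne)
    }

⌈n/2⌉+⌈n/2⌉≤1+n : ∀ k → ⌈ k /2⌉ + ⌈ k /2⌉ ≤ suc k
⌈n/2⌉+⌈n/2⌉≤1+n zero          = z≤n
⌈n/2⌉+⌈n/2⌉≤1+n (suc zero)    = s≤s (s≤s z≤n)
⌈n/2⌉+⌈n/2⌉≤1+n (suc (suc k)) = s≤s (subst (_≤ 2 + k) (sym (+-suc _ _)) (s≤s (⌈n/2⌉+⌈n/2⌉≤1+n k)))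

module _ {k} (G : Graph (Fin (4 + k))) (S : Fin (4 + k) → Bool) (α : IndependenceNumberAtMost G 2)
         {a b c d} (P : DominatingP₄ G S a b c d) where

  extend-immersion : ContainsImmersion (complete ⌈ k /2⌉) (deleteVertices G S) →
    ContainsImmersion (complete (2 + ⌈ k /2⌉)) G
  extend-immersion I with ImmersionVertices.deficient≤helpers⊎ G S I α P refl (⌈n/2⌉+⌈n/2⌉≤1+n k)
  ... | inj₁ fits = Extension.immersion G S I α P fits
  ... | inj₂ fits = Extension.immersion G S I α (DominatingP₄-reverse G S P) fits

module _ {n} (h : Fin 4 → Fin n) where

  imageOf-⇔ : ∀ {v} → T (imageOf h v) ⇔ v ∈ map h (allFin 4)
  imageOf-⇔ {v} = mk⇔
    (Any.map⁺ {f = h} ∘ Any.map (sym ∘ toWitness) ∘ any⁻ hits (allFin 4))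
    (any⁺ hits ∘ Any.map (fromWitness ∘ sym) ∘ Any.map⁻ {f = h})
    where
    hits : Fin 4 → Bool
    hits i = ⌊ h i ≟ v ⌋

  induced-P₄-dominating : (G : Graph (Fin n)) → (∀ i j → h i ≡ h j → i ≡ j) →
    (∀ i j → adj G (h i) (h j) ≡ adj P₄ i j) →
    (∀ i j → Adj P₄ i j → ∀ v → T (not (imageOf h v)) → Adj G (h i) v ⊎ Adj G (h j) v) →
    DominatingP₄ G (imageOf h) (h (# 0)) (h (# 1)) (h (# 2)) (h (# 3))
  induced-P₄-dominating G h-inj h-induced h-dominating = record
    { a≢b = distinct λ () ; a≢c = distinct λ () ; a≢d = distinct λ ()
    ; b≢c = distinct λ () ; b≢d = distinct λ () ; c≢d = distinct λ ()
    ; a∼b = edge (# 0) (# 1) ; c∼d = edge (# 2) (# 3)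
    ; a≁c = non-edge (# 0) (# 2) ; a≁d = non-edge (# 0) (# 3) ; b≁d = non-edge (# 1) (# 3)
    ; deleted = imageOf-⇔
    ; dominated = λ out →
        h-dominating (# 0) (# 1) _ _ out , h-dominating (# 1) (# 2) _ _ out , h-dominating (# 2) (# 3) _ _ out
    }
    where
    distinct : ∀ {i j} → i ≢ j → h i ≢ h j
    distinct i≢j = i≢j ∘ h-inj _ _
    edge : ∀ i j → {T (adj P₄ i j)} → Adj G (h i) (h j)
    edge i j {t} = subst T (sym (h-induced i j)) t
    non-edge : ∀ i j → {T (not (adj P₄ i j))} → ¬ Adj G (h i) (h j)
    non-edge i j {t} = T-not⇒¬T t ∘ subst T (h-induced i j)

lemma4p2 : (n : ℕ) (G : Graph (Fin n)) →
    IndependenceNumberAtMost G 2 →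
    (h : Fin 4 → Fin n) →
    (∀ i j → h i ≡ h j → i ≡ j) →
    (∀ i j → adj G (h i) (h j) ≡ adj P₄ i j) →
    (∀ i j → Adj P₄ i j → ∀ v → T (not (imageOf h v)) → Adj G (h i) v ⊎ Adj G (h j) v) →
    ContainsImmersion (complete ⌈ n ∸ 4 /2⌉) (deleteVertices G (imageOf h)) →
    ContainsImmersion (complete ⌈ n /2⌉) G
lemma4p2 n G α h h-inj h-induced h-dominating with injective⇒≤ {f = h} (h-inj _ _)
... | s≤s (s≤s (s≤s (s≤s _))) =
  extend-immersion G (imageOf h) α (induced-P₄-dominating h G h-inj h-induced h-dominating)
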